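{- For every integer $n\ge 1$, the molecular graph of the alkane $C_nH_{2n+2}$ is a $G_\phi$-graph, where this molecular graph is the tree whose $n$ carbon vertices form a path $c_1c_2\cdots c_n$ and in which each carbon vertex is additionally joined to new leaf (hydrogen) vertices so that every carbon has degree exactly $4$ (for $n=1$ this is $K_{1,4}$).
   Context: $\phi$ denotes Euler's totient function, $\phi^0(n)=n$ and $\phi^i(n)=\phi(\phi^{i-1}(n))$. For a set $A$ of positive integers, $A_\phi=\{\phi^k(n): n\in A,\ k\ge 0\}$, and $G_\phi(A)$ is the simple graph with vertex set $A_\phi$ in which distinct vertices $r,s$ are adjacent iff $\phi(r)=s$ or $\phi(s)=r$. A graph $H$ is a $G_\phi$-graph if $H$ is isomorphic to $G_\phi(A)$ for some set $A$ of positive integers. -}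

module Defs where

open import Level using (0ℓ)
open import Data.Nat using (ℕ; zero; suc; _+_; _∸_; _≤_)
open import Data.Nat.GCD using (gcd)
open import Data.Nat.Properties using (_≟_)
open import Data.Fin using (Fin; toℕ)
open import Data.List using (List; length; filter; upTo; map)
open import Data.Product using (Σ; ∃; _×_)
open import Data.Sum using (_⊎_)
open import Data.Empty using (⊥)
open import Function using (_∘_)
open import Function.Bundles using (_⇔_)
open import Function.Definitions using (Injective)
open import Relation.Nullary using (¬_)
open import Relation.Binary.PropositionalEquality using (_≡_)

φ : ℕ → ℕ
φ n = length (filter (λ k → gcd k n ≟ 1) (map suc (upTo n)))

φ^ : ℕ → ℕ → ℕ
φ^ zero    n = n
φ^ (suc i) n = φ (φ^ i n)

Aφ : (ℕ → Set) → ℕ → Set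
Aφ A m = Σ ℕ λ n → Σ ℕ λ k → A n × φ^ k n ≡ m

GφAdj : ℕ → ℕ → Set
GφAdj r s = ¬ (r ≡ s) × (φ r ≡ s ⊎ φ s ≡ r)

IsoToGφ : (V : Set) → (V → V → Set) → (ℕ → Set) → Set
IsoToGφ V Adj A = Σ (V → ℕ) λ f →
    Injective _≡_ _≡_ f
  × ((v : V) → Aφ A (f v))
  × ((m : ℕ) → Aφ A m → Σ V λ v → f v ≡ m)
  × ((u v : V) → Adj u v ⇔ GφAdj (f u) (f v))

IsGφGraph : (V : Set) → (V → V → Set) → Set₁
IsGφGraph V Adj = Σ (ℕ → Set) λ A → ((n : ℕ) → A n → 1 ≤ n) × IsoToGφ V Adj A

-- Molecular graph of the alkane C_n H_{2n+2}.
-- Carbons c_0 … c_{n-1} on a path; carbon i has cdeg n i carbon neighbours,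
-- and 4 ∸ cdeg n i hydrogen leaves, so each carbon has degree 4.
[_<_]? : ℕ → ℕ → ℕ
[ a < b ]? with suc a Data.Nat.≤? b
... | Relation.Nullary.yes _ = 1
... | Relation.Nullary.no _ = 0

cdeg : (n : ℕ) → Fin n → ℕ
cdeg n i = [ 0 < toℕ i ]? + [ suc (toℕ i) < n ]?

data AlkV (n : ℕ) : Set where
  C : Fin n → AlkV n
  H : (i : Fin n) → Fin (4 ∸ cdeg n i) → AlkV n

AlkAdj : (n : ℕ) → AlkV n → AlkV n → Set
AlkAdj n (C i)   (C j)   = suc (toℕ i) ≡ toℕ j ⊎ suc (toℕ j) ≡ toℕ i
AlkAdj n (C i)   (H j _) = i ≡ j
AlkAdj n (H i _) (C j)   = i ≡ j
AlkAdj n (H _ _) (H _ _) = ⊥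

-- Label a vertex by 2^e·(2q+1), encoded as the pair (e , q). The carbons get 2, 4, …, 2^n; the
-- carbon 2^k gets the hydrogens 3·2^k and 5·2^(k-1) (3 when k = 1), and the two end hydrogens get
-- 1 and 2^(n+1), so that the carbon chain together with its end hydrogens is the path
-- 1, 2, 4, …, 2^(n+1). Since φ(2m) = 2φ(m) for even m, φ maps every label other than 1 to the
-- label of the neighbour one step closer to the hydrogen 1, and φ(1) = 1. So the labels are closed
-- under φ, and for A the set of labels, G_φ(A) is the alkane.
module Submission where

open import Level using (Level)
open import Defs
open import Data.Nat
open import Data.Nat.Properties
open import Data.Nat.Divisibility using (_∣_; ∣-trans; ∣m∣n⇒∣m+n; ∣m+n∣m⇒∣n; ∣m⇒∣m*n; ∣n⇒∣m*n; m∣m*n; ∣1⇒≡1)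
open import Data.Nat.GCD using (gcd)
open import Data.Nat.Coprimality using (Coprime; coprime⇒gcd≡1; gcd≡1⇒coprime; coprime-+; coprime-divisor)
open import Data.Fin using (Fin; zero; suc; toℕ; inject₁)
open import Data.Fin.Properties using (toℕ-injective; toℕ<n; toℕ-inject₁)
open import Data.List using (_∷_; _++_; length; filter; applyUpTo)
open import Data.List.Properties using (length-++; filter-++; map-upTo)
open import Data.Product using (_×_; _,_; proj₁; proj₂; ∃)
open import Data.Product.Function.NonDependent.Propositional using (_×-⇔_)
open import Data.Sum using (_⊎_; inj₁; inj₂; swap)
open import Data.Sum.Function.Propositional using (_⊎-⇔_)
open import Data.Empty using (⊥-elim)
open import Function using (_∘_)
open import Function.Bundles using (_⇔_; mk⇔; Equivalence)
open import Function.Definitions using (Injective)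
import Function.Properties.Equivalence as ⇔
open import Function.Related.TypeIsomorphisms using (¬-cong-⇔)
open import Relation.Nullary using (¬_; Dec; yes; no; contradiction)
open import Relation.Nullary.Decidable using (_×-dec_)
open import Relation.Unary using (Pred; Decidable)
open import Relation.Binary.PropositionalEquality

private variable ℓ : Level

length-filter-applyUpTo : ∀ {P Q : Pred ℕ ℓ} (P? : Decidable P) (Q? : Decidable Q) {f g : ℕ → ℕ} n →
  (∀ k → P (f k) ⇔ Q (g k)) →
  length (filter P? (applyUpTo f n)) ≡ length (filter Q? (applyUpTo g n))
length-filter-applyUpTo P? Q? zero P⇔Q = refl
length-filter-applyUpTo P? Q? {f} {g} (suc n) P⇔Q with P? (f 0) | Q? (g 0)
... | yes _ | yes _   = cong suc (length-filter-applyUpTo P? Q? n (P⇔Q ∘ suc))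
... | no _  | no _    = length-filter-applyUpTo P? Q? n (P⇔Q ∘ suc)
... | yes p | no ¬q   = ⊥-elim (¬q (Equivalence.to (P⇔Q 0) p))
... | no ¬p | yes q   = ⊥-elim (¬p (Equivalence.from (P⇔Q 0) q))

applyUpTo-+ : ∀ {a} {A : Set a} (f : ℕ → A) m n →
  applyUpTo f (m + n) ≡ applyUpTo f m ++ applyUpTo (f ∘ (m +_)) n
applyUpTo-+ f zero    n = refl
applyUpTo-+ f (suc m) n = cong (f 0 ∷_) (applyUpTo-+ (f ∘ suc) m n)

gcd≡1⇔coprime : ∀ {m n} → (gcd m n ≡ 1) ⇔ Coprime m n
gcd≡1⇔coprime = mk⇔ gcd≡1⇒coprime coprime⇒gcd≡1

coprime-+ˡ⇔ : ∀ m n → Coprime (m + n) m ⇔ Coprime n m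
coprime-+ˡ⇔ m n = mk⇔ (λ c {_} (d∣n , d∣m) → c (∣m∣n⇒∣m+n d∣m d∣n , d∣m)) coprime-+

-- a common divisor e of k and d * m is coprime to m (its common divisors with m divide k),
-- hence e ∣ d ∣ m
coprime-*-divisor⇔ : ∀ {d m} k → d ∣ m → Coprime k (d * m) ⇔ Coprime k m
coprime-*-divisor⇔ {d} {m} k d∣m = mk⇔
  (λ c {_} (e∣k , e∣m) → c (e∣k , ∣n⇒∣m*n d e∣m))
  (λ c {e} (e∣k , e∣dm) →
     let e⊥m : Coprime e m
         e⊥m {_} (f∣e , f∣m) = c (∣-trans f∣e e∣k , f∣m)
     in c (e∣k , ∣-trans (coprime-divisor e⊥m (subst (e ∣_) (*-comm d m) e∣dm)) d∣m))

coprimeCount : ℕ → ℕ → ℕ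
coprimeCount m N = length (filter (λ k → gcd k m ≟ 1) (applyUpTo suc N))

φ≡coprimeCount : ∀ m → φ m ≡ coprimeCount m m
φ≡coprimeCount m = cong (length ∘ filter (λ k → gcd k m ≟ 1)) (map-upTo suc m)

coprimeCount-+ : ∀ m N → coprimeCount m (m + N) ≡ φ m + coprimeCount m N
coprimeCount-+ m N = begin
  coprimeCount m (m + N)
    ≡⟨ cong (length ∘ filter P?) (applyUpTo-+ suc m N) ⟩
  length (filter P? (applyUpTo suc m ++ applyUpTo (λ k → suc (m + k)) N))
    ≡⟨ cong length (filter-++ P? (applyUpTo suc m) _) ⟩
  length (filter P? (applyUpTo suc m) ++ filter P? (applyUpTo (λ k → suc (m + k)) N))
    ≡⟨ length-++ (filter P? (applyUpTo suc m)) ⟩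
  coprimeCount m m + length (filter P? (applyUpTo (λ k → suc (m + k)) N))
    ≡⟨ cong₂ _+_ (sym (φ≡coprimeCount m)) (length-filter-applyUpTo P? P? N shift) ⟩
  φ m + coprimeCount m N ∎
  where
  open ≡-Reasoning
  P? = λ k → gcd k m ≟ 1
  shift : ∀ k → (gcd (suc (m + k)) m ≡ 1) ⇔ (gcd (suc k) m ≡ 1)
  shift k = ⇔.trans gcd≡1⇔coprime (⇔.trans
    (subst (λ x → Coprime x m ⇔ Coprime (suc k) m) (+-suc m k) (coprime-+ˡ⇔ m (suc k)))
    (⇔.sym gcd≡1⇔coprime))

coprimeCount-* : ∀ c m → coprimeCount m (c * m) ≡ c * φ m
coprimeCount-* zero    m = refl
coprimeCount-* (suc c) m = trans (coprimeCount-+ m (c * m)) (cong (φ m +_) (coprimeCount-* c m))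

φ-*-divisor : ∀ {d m} → d ∣ m → φ (d * m) ≡ d * φ m
φ-*-divisor {d} {m} d∣m = begin
  φ (d * m)                      ≡⟨ φ≡coprimeCount (d * m) ⟩
  coprimeCount (d * m) (d * m)   ≡⟨ length-filter-applyUpTo _ _ (d * m) same ⟩
  coprimeCount m (d * m)         ≡⟨ coprimeCount-* d m ⟩
  d * φ m                        ∎
  where
  open ≡-Reasoning
  same : ∀ k → (gcd (suc k) (d * m) ≡ 1) ⇔ (gcd (suc k) m ≡ 1)
  same k = ⇔.trans gcd≡1⇔coprime (⇔.trans (coprime-*-divisor⇔ (suc k) d∣m) (⇔.sym gcd≡1⇔coprime))

φ-2^suc-* : ∀ e o → φ (2 ^ suc e * o) ≡ 2 ^ e * φ (2 * o)
φ-2^suc-* zero    o = sym (*-identityˡ _)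
φ-2^suc-* (suc e) o = begin
  φ (2 ^ suc (suc e) * o)   ≡⟨ cong φ (*-assoc 2 (2 ^ suc e) o) ⟩
  φ (2 * (2 ^ suc e * o))   ≡⟨ φ-*-divisor (∣m⇒∣m*n o (m∣m*n {2} (2 ^ e))) ⟩
  2 * φ (2 ^ suc e * o)     ≡⟨ cong (2 *_) (φ-2^suc-* e o) ⟩
  2 * (2 ^ e * φ (2 * o))   ≡⟨ *-assoc 2 (2 ^ e) _ ⟨
  2 ^ suc e * φ (2 * o)     ∎
  where open ≡-Reasoning

dyadic : ℕ × ℕ → ℕ
dyadic (e , q) = 2 ^ e * (1 + 2 * q)

dyadic-positive : ∀ c → 1 ≤ dyadic c
dyadic-positive (e , q) = *-mono-≤ (m^n>0 2 e) (s≤s z≤n)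

odd≢even : ∀ q m → 1 + 2 * q ≢ 2 * m
odd≢even q m eq = contradiction (∣1⇒≡1 (∣m+n∣m⇒∣n 2∣2q+1 (m∣m*n q))) λ ()
  where
  2∣2q+1 : 2 ∣ 2 * q + 1
  2∣2q+1 = subst (2 ∣_) (trans (sym eq) (+-comm 1 (2 * q))) (m∣m*n m)

dyadic-zero : ∀ q → dyadic (0 , q) ≡ 1 + 2 * q
dyadic-zero q = *-identityˡ (1 + 2 * q)

dyadic-suc : ∀ e q → dyadic (suc e , q) ≡ 2 * dyadic (e , q)
dyadic-suc e q = *-assoc 2 (2 ^ e) (1 + 2 * q)

dyadic-injective : Injective _≡_ _≡_ dyadic
dyadic-injective {zero , q} {zero , q′} eq = cong (0 ,_) (*-cancelˡ-≡ q q′ 2 (suc-injective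
  (trans (sym (dyadic-zero q)) (trans eq (dyadic-zero q′)))))
dyadic-injective {zero , q} {suc e′ , q′} eq = ⊥-elim (odd≢even q (dyadic (e′ , q′))
  (trans (sym (dyadic-zero q)) (trans eq (dyadic-suc e′ q′))))
dyadic-injective {suc e , q} {zero , q′} eq = ⊥-elim (odd≢even q′ (dyadic (e , q))
  (trans (sym (dyadic-zero q′)) (trans (sym eq) (dyadic-suc e q))))
dyadic-injective {suc e , q} {suc e′ , q′} eq
  with refl ← dyadic-injective {e , q} {e′ , q′} (*-cancelˡ-≡ _ _ 2
                (trans (sym (dyadic-suc e q)) (trans eq (dyadic-suc e′ q′))))
  = refl

2^m*2^n≡2^[n+m] : ∀ m n → 2 ^ m * 2 ^ n ≡ dyadic (n + m , 0)
2^m*2^n≡2^[n+m] m n = trans (*-comm (2 ^ m) (2 ^ n))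
  (trans (sym (^-distribˡ-+-* 2 n m)) (sym (*-identityʳ _)))

φ-dyadic-0 : ∀ e → φ (dyadic (suc (suc e) , 0)) ≡ dyadic (suc e , 0)
φ-dyadic-0 e = φ-2^suc-* (suc e) 1

φ-dyadic-1 : ∀ e → φ (dyadic (suc e , 1)) ≡ dyadic (suc e , 0)
φ-dyadic-1 e = trans (φ-2^suc-* e 3) (2^m*2^n≡2^[n+m] e 1)

φ-dyadic-2 : ∀ e → φ (dyadic (suc e , 2)) ≡ dyadic (suc (suc e) , 0)
φ-dyadic-2 e = trans (φ-2^suc-* e 5) (2^m*2^n≡2^[n+m] e 2)

module _ {V : Set} {Adj : V → V → Set} (label : V → ℕ) (parent : V → V)
         (label-injective : Injective _≡_ _≡_ label)
         (label-parent : ∀ v → label (parent v) ≡ φ (label v)) where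

  φ^-label : ∀ k v → ∃ λ w → label w ≡ φ^ k (label v)
  φ^-label zero    v = v , refl
  φ^-label (suc k) v with w , eq ← φ^-label k v = parent w , trans (label-parent w) (cong φ eq)

  label-≡⇔ : ∀ {u v} → (label u ≡ label v) ⇔ (u ≡ v)
  label-≡⇔ = mk⇔ label-injective (cong label)

  φ-label-≡⇔ : ∀ u v → (φ (label u) ≡ label v) ⇔ (parent u ≡ v)
  φ-label-≡⇔ u v = ⇔.trans (mk⇔ (trans (label-parent u)) (trans (sym (label-parent u)))) label-≡⇔

  GφAdj-label⇔ : ∀ u v → GφAdj (label u) (label v) ⇔ (u ≢ v × (parent u ≡ v ⊎ parent v ≡ u))
  GφAdj-label⇔ u v = ¬-cong-⇔ label-≡⇔ ×-⇔ (φ-label-≡⇔ u v ⊎-⇔ φ-label-≡⇔ v u)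

  parentLabelling⇒IsGφGraph : (∀ v → 1 ≤ label v) →
    (∀ u v → Adj u v ⇔ (u ≢ v × (parent u ≡ v ⊎ parent v ≡ u))) → IsGφGraph V Adj
  parentLabelling⇒IsGφGraph label-positive Adj⇔parent =
    Image , positive , label , label-injective , inAφ , Aφ⊆image ,
    λ u v → ⇔.trans (Adj⇔parent u v) (⇔.sym (GφAdj-label⇔ u v))
    where
    Image : ℕ → Set
    Image m = ∃ λ v → label v ≡ m
    positive : ∀ m → Image m → 1 ≤ m
    positive _ (v , refl) = label-positive v
    inAφ : ∀ v → Aφ Image (label v)
    inAφ v = label v , 0 , (v , refl) , refl
    Aφ⊆image : ∀ m → Aφ Image m → ∃ λ v → label v ≡ m
    Aφ⊆image m (_ , k , (v , refl) , eq) with w , eq′ ← φ^-label k v = w , trans eq′ eq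

-- Hydrogen 2 of carbon 0
-- is the end hydrogen 1; the last hydrogen of the last carbon (index 2, or 3 if n = 1) is the
-- other end hydrogen 2^(i+2).
hydrogenCode : ℕ → ℕ → ℕ × ℕ
hydrogenCode i       0                   = (suc i , 1)
hydrogenCode i       (suc (suc (suc _))) = (suc (suc i) , 0)
hydrogenCode 0       1                   = (0 , 1)
hydrogenCode (suc a) 1                   = (suc a , 2)
hydrogenCode 0       2                   = (0 , 0)
hydrogenCode (suc a) 2                   = (suc (suc (suc a)) , 0)

LeftCap : ℕ → ℕ → Set
LeftCap i j = i ≡ 0 × j ≡ 2

leftCap? : ∀ i j → Dec (LeftCap i j)
leftCap? i j = i ≟ 0 ×-dec j ≟ 2

φ-hydrogenCode : ∀ i j → ¬ LeftCap i j → φ (dyadic (hydrogenCode i j)) ≡ dyadic (suc i , 0)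
φ-hydrogenCode i       0                   _   = φ-dyadic-1 i
φ-hydrogenCode i       (suc (suc (suc _))) _   = φ-dyadic-0 i
φ-hydrogenCode 0       1                   _   = refl
φ-hydrogenCode (suc a) 1                   _   = φ-dyadic-2 a
φ-hydrogenCode 0       2                   ¬lc = contradiction (refl , refl) ¬lc
φ-hydrogenCode (suc a) 2                   _   = φ-dyadic-0 (suc a)

data Slot (n : ℕ) : ℕ → ℕ → Set where
  side₀     : ∀ {i} → Slot n i 0
  side₁     : ∀ {i} → Slot n i 1
  leftCap   : Slot n 0 2
  rightCap₀ : n ≡ 1 → Slot n 0 3
  rightCap  : ∀ {a} → 2 + a ≡ n → Slot n (suc a) 2

<1+k∸[a<b]?⇒b≤a : ∀ a b {k} → k < suc k ∸ [ a < b ]? → b ≤ a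
<1+k∸[a<b]?⇒b≤a a b k< with suc a ≤? b
... | yes _   = contradiction k< (n≮n _)
... | no a≮b = ≮⇒≥ a≮b

slotAt : ∀ {n i j} → i < n → j < 4 ∸ ([ 0 < i ]? + [ suc i < n ]?) → Slot n i j
slotAt {j = 0} _ _ = side₀
slotAt {j = 1} _ _ = side₁
slotAt {n} {0} {2} _ _ = leftCap
slotAt {n} {0} {3} 0<n j< = rightCap₀ (≤-antisym (<1+k∸[a<b]?⇒b≤a 1 n j<) 0<n)
slotAt {n} {0} {suc (suc (suc (suc k)))} _ j< = contradiction (<-≤-trans j< (m∸n≤m 4 [ 1 < n ]?)) (m+n≮m 4 k)
slotAt {n} {suc a} {2} i<n j< = rightCap (≤-antisym i<n (<1+k∸[a<b]?⇒b≤a (2 + a) n j<))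
slotAt {n} {suc a} {suc (suc (suc k))} _ j< = contradiction (<-≤-trans j< (m∸n≤m 3 [ 2 + a < n ]?)) (m+n≮m 3 k)

slot : ∀ {n} (i : Fin n) (j : Fin (4 ∸ cdeg n i)) → Slot n (toℕ i) (toℕ j)
slot i j = slotAt (toℕ<n i) (toℕ<n j)

slotOf : ℕ × ℕ → ℕ × ℕ
slotOf (suc i , 1)                 = (i , 0)
slotOf (0 , 1)                     = (0 , 1)
slotOf (suc a , 2)                 = (suc a , 1)
slotOf (0 , 0)                     = (0 , 2)
slotOf (2 , 0)                     = (0 , 3)
slotOf (suc (suc (suc a)) , 0)     = (suc a , 2)
slotOf _                           = (0 , 0)   -- not a hydrogen code

slotOf-hydrogenCode : ∀ {n i j} → Slot n i j → slotOf (hydrogenCode i j) ≡ (i , j)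
slotOf-hydrogenCode side₀           = refl
slotOf-hydrogenCode (side₁ {zero})  = refl
slotOf-hydrogenCode (side₁ {suc _}) = refl
slotOf-hydrogenCode leftCap         = refl
slotOf-hydrogenCode (rightCap₀ _)   = refl
slotOf-hydrogenCode (rightCap _)    = refl

hydrogenCode-injective : ∀ {n i j i′ j′} → Slot n i j → Slot n i′ j′ →
  hydrogenCode i j ≡ hydrogenCode i′ j′ → (i , j) ≡ (i′ , j′)
hydrogenCode-injective s s′ eq =
  trans (sym (slotOf-hydrogenCode s)) (trans (cong slotOf eq) (slotOf-hydrogenCode s′))

-- Only a right cap has the shape of a carbon code, namely that of the carbon one past the chain.
carbonCode≢hydrogenCode : ∀ {n c i j} → c < n → Slot n i j → (suc c , 0) ≢ hydrogenCode i j
carbonCode≢hydrogenCode c<n (rightCap₀ refl) refl = n≮n 1 c<n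
carbonCode≢hydrogenCode c<n (rightCap refl)  refl = n≮n _ c<n
carbonCode≢hydrogenCode _ side₀           ()
carbonCode≢hydrogenCode _ (side₁ {zero})  ()
carbonCode≢hydrogenCode _ (side₁ {suc _}) ()
carbonCode≢hydrogenCode _ leftCap         ()

module _ {n : ℕ} where

  code : AlkV n → ℕ × ℕ
  code (C i)   = (suc (toℕ i) , 0)
  code (H i j) = hydrogenCode (toℕ i) (toℕ j)

  code-injective : Injective _≡_ _≡_ code
  code-injective {C i}   {C j}   eq = cong C (toℕ-injective (suc-injective (cong proj₁ eq)))
  code-injective {C i}   {H j k} eq = ⊥-elim (carbonCode≢hydrogenCode (toℕ<n i) (slot j k) eq)
  code-injective {H i k} {C j}   eq = ⊥-elim (carbonCode≢hydrogenCode (toℕ<n j) (slot i k) (sym eq))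
  code-injective {H i k} {H j l} eq with hydrogenCode-injective (slot i k) (slot j l) eq
  ... | eq′ with refl ← toℕ-injective (cong proj₁ eq′) = cong (H i) (toℕ-injective (cong proj₂ eq′))

  label : AlkV n → ℕ
  label = dyadic ∘ code

leftCapIndex : ∀ m → Fin (4 ∸ cdeg (suc m) zero)
leftCapIndex zero    = suc (suc zero)
leftCapIndex (suc m) = suc (suc zero)

toℕ-leftCapIndex : ∀ m → toℕ (leftCapIndex m) ≡ 2
toℕ-leftCapIndex zero    = refl
toℕ-leftCapIndex (suc m) = refl

parent : ∀ {n} → AlkV n → AlkV n
parent {suc m} (C zero) = H zero (leftCapIndex m)
parent (C (suc i))      = C (inject₁ i)
parent (H i j) with leftCap? (toℕ i) (toℕ j)
... | yes _ = H i j
... | no _  = C i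

label-parent : ∀ {n} (v : AlkV n) → label (parent v) ≡ φ (label v)
label-parent {suc zero}    (C zero) = refl
label-parent {suc (suc m)} (C zero) = refl
label-parent (C (suc i)) =
  trans (cong (λ k → dyadic (suc k , 0)) (toℕ-inject₁ i)) (sym (φ-dyadic-0 (toℕ i)))
label-parent (H i j) with leftCap? (toℕ i) (toℕ j)
... | yes (i≡0 , j≡2) =
  subst₂ (λ a b → dyadic (hydrogenCode a b) ≡ φ (dyadic (hydrogenCode a b))) (sym i≡0) (sym j≡2) refl
... | no ¬lc = sym (φ-hydrogenCode (toℕ i) (toℕ j) ¬lc)

AlkAdj-sym : ∀ {n} (u v : AlkV n) → AlkAdj n u v → AlkAdj n v u
AlkAdj-sym (C i)   (C j)   = swap
AlkAdj-sym (C i)   (H j k) = sym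
AlkAdj-sym (H i k) (C j)   = sym

AlkAdj-irrefl : ∀ {n} (u : AlkV n) → ¬ AlkAdj n u u
AlkAdj-irrefl (C i) (inj₁ e) = 1+n≢n e
AlkAdj-irrefl (C i) (inj₂ e) = 1+n≢n e

parent-C : ∀ {n} {i j : Fin n} → suc (toℕ i) ≡ toℕ j → parent (C j) ≡ C i
parent-C {j = suc j} e = cong C (toℕ-injective (trans (toℕ-inject₁ j) (suc-injective (sym e))))

carbon-hydrogen-parent : ∀ {n} (i : Fin n) k → parent (C i) ≡ H i k ⊎ parent (H i k) ≡ C i
carbon-hydrogen-parent i k with leftCap? (toℕ i) (toℕ k)
carbon-hydrogen-parent {suc m} zero k | yes (_ , k≡2) =
  inj₁ (cong (H zero) (toℕ-injective (trans (toℕ-leftCapIndex m) (sym k≡2))))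
carbon-hydrogen-parent (suc i) k | yes (() , _)
... | no _ = inj₂ refl

AlkAdj⇒parent : ∀ {n} (u v : AlkV n) → AlkAdj n u v → parent u ≡ v ⊎ parent v ≡ u
AlkAdj⇒parent (C i)   (C j)    (inj₁ e) = inj₂ (parent-C e)
AlkAdj⇒parent (C i)   (C j)    (inj₂ e) = inj₁ (parent-C e)
AlkAdj⇒parent (C i)   (H .i k) refl     = carbon-hydrogen-parent i k
AlkAdj⇒parent (H i k) (C .i)   refl     = swap (carbon-hydrogen-parent i k)

parent⇒AlkAdj : ∀ {n} (u v : AlkV n) → parent u ≡ v → u ≢ v → AlkAdj n u v
parent⇒AlkAdj {suc m} (C zero) _ refl _ = refl
parent⇒AlkAdj (C (suc i)) _ refl _ = inj₂ (cong suc (toℕ-inject₁ i))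
parent⇒AlkAdj (H i j) v e u≢v with leftCap? (toℕ i) (toℕ j)
... | yes _ = contradiction e u≢v
... | no _  = subst (AlkAdj _ (H i j)) e refl

AlkAdj⇔parent : ∀ {n} (u v : AlkV n) → AlkAdj n u v ⇔ (u ≢ v × (parent u ≡ v ⊎ parent v ≡ u))
AlkAdj⇔parent u v = mk⇔
  (λ adj → (λ { refl → AlkAdj-irrefl u adj }) , AlkAdj⇒parent u v adj)
  λ { (u≢v , inj₁ e) → parent⇒AlkAdj u v e u≢v
    ; (u≢v , inj₂ e) → AlkAdj-sym v u (parent⇒AlkAdj v u e (u≢v ∘ sym)) }

theorem3p3 : (n : ℕ) → 1 ≤ n → IsGφGraph (AlkV n) (AlkAdj n)
theorem3p3 n _ = parentLabelling⇒IsGφGraph label parent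
  (code-injective ∘ dyadic-injective) label-parent (dyadic-positive ∘ code) AlkAdj⇔parent
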